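{- Let $\mathcal N$ and $\mathcal N'$ be orchard networks on $X$ with $\Sigma_{\mathcal N}=\Sigma_{\mathcal N'}$, where the non-leaf vertices of both networks are labelled $v_1,\dots,v_t$ so that the ancestral tuples coincide. If $v_i$ and $v_j$ are a maximal pair of clones of $\mathcal N$, then $v_i$ and $v_j$ are both reticulations of $\mathcal N$ if and only if $v_i$ and $v_j$ are both reticulations of $\mathcal N'$.
   Context: A phylogenetic network on a non-empty finite set $X$ is a rooted acyclic directed graph with no parallel arcs such that: (i) the unique root has in-degree $0$ and out-degree $2$; (ii) every vertex of out-degree $0$ has in-degree $1$, and the set of vertices of out-degree $0$ (the leaves) is $X$; (iii) every other vertex either has in-degree $1$ and out-degree $2$ (a tree vertex) or in-degree at least $2$ and out-degree $1$ (a reticulation). If $|X|=1$, a single vertex is also allowed. If $(u,v)$ is an arc, $u$ is a parent of $v$. A 2-element subset $\{a,b\}\subseteq X$ with parents $p_a,p_b$ is a cherry if $p_a=p_b$; it is a reticulated cherry with reticulation leaf $b$ if $p_b$ is a reticulation and $(p_a,p_b)$ is an arc. Reducing $b$ in a cherry: delete $b$ and suppress the resulting in-degree-1 out-degree-1 vertex (if the common parent is the root, delete $b$ and the root). Cutting a reticulated cherry $\{a,b\}$: delete the arc $(p_a,p_b)$ and suppress any resulting in-degree-1 out-degree-1 vertices. A phylogenetic network is orchard if some sequence of these cherry reductions transforms it into a single vertex. Ancestral profile: with a labelling $v_1,\dots,v_t$ of the non-leaf vertices, $\sigma_i(x)$ is the number of directed paths from $v_i$ to the leaf $x$, $\sigma(x)=(\sigma_1(x),\dots,\sigma_t(x))$,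 and $\Sigma_{\mathcal N}=\{(x,\sigma(x)):x\in X\}$. $\Sigma_{\mathcal N}=\Sigma_{\mathcal N'}$ means that for some labelling of the non-leaf vertices of $\mathcal N'$ the two sets coincide; the $i$-th non-leaf vertex of each network is then referred to as $v_i$. Distinct non-leaf vertices $v_i,v_j$ are clones if $\sigma_i(x)=\sigma_j(x)$ for all $x\in X$. They are a maximal pair of clones if they are clones and there is no further non-leaf vertex $v_k\notin\{v_i,v_j\}$ such that every two of $v_i,v_j,v_k$ are clones. -}

module Defs where

open import Data.Nat using (ℕ; zero; suc; _≤_; _≟_)
open import Data.Fin using (Fin)
open import Data.Bool using (if_then_else_)
open import Data.List using (List; []; _∷_; length; filter; map)
open import Data.Nat.ListAction using (sum)
open import Data.List.Membership.Propositional using (_∈_)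
open import Data.List.Relation.Unary.Unique.Propositional using (Unique)
open import Data.Product using (_×_; _,_; proj₁; proj₂; ∃; ∃-syntax)
open import Data.Product.Properties using (≡-dec)
open import Data.Sum using (_⊎_)
open import Relation.Nullary using (¬_; ¬?; does)
open import Relation.Binary.PropositionalEquality using (_≡_; _≢_)
open import Function.Bundles using (_⇔_)

-- Finite directed graphs.  Vertices are natural numbers; leaves are
-- identified with their labels (so a leaf named x is the leaf labelled x).

record Graph : Set where
  constructor graph
  field
    V : List ℕ
    A : List (ℕ × ℕ)
open Graph public

_≟ₐ_ : (e f : ℕ × ℕ) → Relation.Nullary.Dec (e ≡ f)
_≟ₐ_ = ≡-dec _≟_ _≟_

parentsOf : Graph → ℕ → List ℕ
parentsOf N v = map proj₁ (filter (λ e → proj₂ e ≟ v) (A N))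

childrenOf : Graph → ℕ → List ℕ
childrenOf N v = map proj₂ (filter (λ e → proj₁ e ≟ v) (A N))

indeg outdeg : Graph → ℕ → ℕ
indeg N v = length (parentsOf N v)
outdeg N v = length (childrenOf N v)

Leaf : Graph → ℕ → Set
Leaf N x = x ∈ V N × outdeg N x ≡ 0

Reticulation : Graph → ℕ → Set
Reticulation N v = v ∈ V N × 2 ≤ indeg N v × outdeg N v ≡ 1

data Path⁺ (N : Graph) : ℕ → ℕ → Set where
  arc  : ∀ {u w} → (u , w) ∈ A N → Path⁺ N u w
  _∷ₚ_ : ∀ {u v w} → (u , v) ∈ A N → Path⁺ N v w → Path⁺ N u w

Acyclic : Graph → Set
Acyclic N = ∀ v → ¬ Path⁺ N v v

record IsNetworkOn (N : Graph) (X : List ℕ) : Set where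
  field
    uniqueV   : Unique (V N)
    uniqueA   : Unique (A N)
    endpoints : ∀ {u w} → (u , w) ∈ A N → u ∈ V N × w ∈ V N
    acyclic   : Acyclic N
    leaves    : ∀ x → (x ∈ X) ⇔ Leaf N x
    shape     :
      (∃[ x ] V N ≡ x ∷ [])
      ⊎
      (∃[ r ] (r ∈ V N × indeg N r ≡ 0 × outdeg N r ≡ 2 ×
        (∀ v → v ∈ V N → v ≢ r →
             (indeg N v ≡ 1 × outdeg N v ≡ 0)
           ⊎ (indeg N v ≡ 1 × outdeg N v ≡ 2)
           ⊎ (2 ≤ indeg N v × outdeg N v ≡ 1))))

deleteVertex : ℕ → Graph → Graph
deleteVertex v N = graph (filter (λ u → ¬? (u ≟ v)) (V N))
                         (filter (λ e → ¬? (proj₁ e ≟ v)) (filter (λ e → ¬? (proj₂ e ≟ v)) (A N)))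

deleteArc : ℕ × ℕ → Graph → Graph
deleteArc e N = graph (V N) (filter (λ f → ¬? (f ≟ₐ e)) (A N))

suppress : ℕ → Graph → Graph
suppress v N with parentsOf N v | childrenOf N v
... | u ∷ [] | w ∷ [] = graph (V (deleteVertex v N)) ((u , w) ∷ A (deleteVertex v N))
... | _      | _      = N

reduceCherry : ℕ → ℕ → Graph → Graph
reduceCherry b p N =
  if does (indeg N p ≟ 0)
  then deleteVertex p (deleteVertex b N)
  else suppress p (deleteVertex b N)

cutReticulatedCherry : ℕ → ℕ → Graph → Graph
cutReticulatedCherry pa pb N = suppress pb (suppress pa (deleteArc (pa , pb) N))

IsCherry : Graph → ℕ → ℕ → ℕ → Set
IsCherry N a b p = a ≢ b × Leaf N a × Leaf N b × (p , a) ∈ A N × (p , b) ∈ A N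

IsReticulatedCherry : Graph → ℕ → ℕ → ℕ → ℕ → Set
IsReticulatedCherry N a b pa pb =
  a ≢ b × Leaf N a × Leaf N b × (pa , a) ∈ A N × (pb , b) ∈ A N
  × Reticulation N pb × (pa , pb) ∈ A N

data Step (N : Graph) : Graph → Set where
  reduce : ∀ a b p → IsCherry N a b p → Step N (reduceCherry b p N)
  cut    : ∀ a b pa pb → IsReticulatedCherry N a b pa pb
         → Step N (cutReticulatedCherry pa pb N)

data Reduces (N : Graph) : Set where
  done : ∀ x → V N ≡ x ∷ [] → A N ≡ [] → Reduces N
  step : ∀ {N'} → Step N N' → Reduces N' → Reduces N

Orchard : Graph → Set
Orchard = Reduces

pathsUpTo : Graph → ℕ → ℕ → ℕ → ℕ
pathsUpTo N zero    v x = if does (v ≟ x) then 1 else 0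
pathsUpTo N (suc k) v x =
  if does (v ≟ x) then 1 else sum (map (λ w → pathsUpTo N k w x) (childrenOf N v))

-- number of directed paths from v to x (exact for acyclic graphs)
numPaths : Graph → ℕ → ℕ → ℕ
numPaths N v x = pathsUpTo N (length (V N)) v x

NonLeaf : Graph → ℕ → Set
NonLeaf N v = v ∈ V N × ¬ (outdeg N v ≡ 0)

record Labelling (N : Graph) (t : ℕ) : Set where
  field
    vtx       : Fin t → ℕ
    nonLeaf   : ∀ i → NonLeaf N (vtx i)
    injective : ∀ i j → vtx i ≡ vtx j → i ≡ j
    surjective : ∀ v → NonLeaf N v → ∃[ i ] vtx i ≡ v
open Labelling public

σ : {N : Graph} {t : ℕ} → Labelling N t → Fin t → ℕ → ℕ
σ {N} L i x = numPaths N (vtx L i) x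

SameProfile : {N N' : Graph} {t : ℕ} → List ℕ → Labelling N t → Labelling N' t → Set
SameProfile X L L' = ∀ i x → x ∈ X → σ L i x ≡ σ L' i x

Clones : {N : Graph} {t : ℕ} → List ℕ → Labelling N t → Fin t → Fin t → Set
Clones X L i j = i ≢ j × (∀ x → x ∈ X → σ L i x ≡ σ L j x)

MaximalClones : {N : Graph} {t : ℕ} → List ℕ → Labelling N t → Fin t → Fin t → Set
MaximalClones X L i j =
  Clones X L i j ×
  ¬ (∃[ k ] (k ≢ i × k ≢ j × Clones X L i k × Clones X L j k))

-- A reticulation has a single child, so its ancestral tuple is that of its child.  If v_i and
-- v_j are a maximal pair of clones and both are reticulations, the child of v_i is either a
-- leaf x or a non-leaf clone of v_i, which by maximality can only be v_j; as v_i → v_j → v_i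
-- would be a cycle, one of them has a leaf x as child, and then both tuples are the unit
-- vector at x.  Conversely, a non-leaf vertex whose tuple is a unit vector is a reticulation:
-- the root and tree vertices have two children, each reaching some leaf, which would give
-- two paths to x.  Since the tuples are shared, the property transfers between N and N'.
module Submission where

open import Defs
open import Data.Nat using (ℕ; zero; suc; _+_; _≤_; s≤s; _≟_)
open import Data.Nat.Properties using (≤-trans; ≤-reflexive; m≤m+n; m≤n+m; +-mono-≤; +-identityʳ; n<1+n; 1+n≢0; module ≤-Reasoning)
open import Data.Nat.ListAction using (sum)
open import Data.Fin using (Fin; _<_)
open import Data.Fin.Properties using (pigeonhole) renaming (_≟_ to _≟ᶠ_)
open import Data.Bool using (if_then_else_)
open import Data.List using (List; []; _∷_; length; map)
open import Data.List.Properties using (map-cong-local)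
open import Data.List.Membership.Propositional using (_∈_)
open import Data.List.Membership.Propositional.Properties using (∈-map⁻; ∈-filter⁻)
open import Data.List.Membership.Setoid.Properties using (index-injective)
open import Data.List.Relation.Unary.Any using (here; there; index)
import Data.List.Relation.Unary.All as All
open import Data.Product using (_×_; _,_; proj₁; proj₂; ∃-syntax)
open import Data.Sum using (inj₁; inj₂; _⊎_)
open import Data.Empty using (⊥-elim)
open import Function using (_∘_)
open import Function.Bundles using (_⇔_; mk⇔; Equivalence)
open import Relation.Nullary using (¬_; yes; no; does; contradiction)
open import Relation.Nullary.Decidable using (dec-true; dec-false)
open import Relation.Binary.PropositionalEquality
  using (_≡_; _≢_; ≢-sym; refl; sym; trans; cong; subst; setoid)

δ : ℕ → ℕ → ℕ
δ x y = if does (x ≟ y) then 1 else 0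

δ-diag : ∀ x → δ x x ≡ 1
δ-diag x rewrite dec-true (x ≟ x) refl = refl

δ-off : ∀ {x y} → x ≢ y → δ x y ≡ 0
δ-off {x} {y} x≢y rewrite dec-false (x ≟ y) x≢y = refl

δ-positive⇒≡ : ∀ {x y} → 1 ≤ δ x y → x ≡ y
δ-positive⇒≡ {x} {y} 1≤δ with x ≟ y
... | yes x≡y = x≡y
... | no x≢y  = contradiction (≤-trans 1≤δ (≤-reflexive (δ-off x≢y))) λ ()

length≡0⇒[] : ∀ {A : Set} (xs : List A) → length xs ≡ 0 → xs ≡ []
length≡0⇒[] [] _ = refl

length≢0⇒∷ : ∀ {A : Set} (xs : List A) → ¬ length xs ≡ 0 → ∃[ a ] ∃[ as ] xs ≡ a ∷ as
length≢0⇒∷ []       ¬empty = contradiction refl ¬empty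
length≢0⇒∷ (a ∷ as) _      = a , as , refl

length≡1⇒singleton : ∀ {A : Set} (xs : List A) → length xs ≡ 1 → ∃[ a ] xs ≡ a ∷ []
length≡1⇒singleton (a ∷ []) _ = a , refl

length≡2⇒pair : ∀ {A : Set} (xs : List A) → length xs ≡ 2 → ∃[ a ] ∃[ b ] xs ≡ a ∷ b ∷ []
length≡2⇒pair (a ∷ b ∷ []) _ = a , b , refl

module _ (N : Graph) where

  data Walk : ℕ → ℕ → Set where
    []  : ∀ {v} → Walk 0 v
    _∷_ : ∀ {k v w} → (v , w) ∈ A N → Walk k w → Walk (suc k) v

  vertexAt : ∀ {k v} → Walk k v → Fin (suc k) → ℕ
  vertexAt {v = v} _        Fin.zero    = v
  vertexAt         (_ ∷ W) (Fin.suc i) = vertexAt W i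

  path⁺-from : ∀ {k v w} → (v , w) ∈ A N → (W : Walk k w) → ∀ j → Path⁺ N v (vertexAt W j)
  path⁺-from e W       Fin.zero    = arc e
  path⁺-from e (e′ ∷ W) (Fin.suc j) = e ∷ₚ path⁺-from e′ W j

  path⁺-between : ∀ {k v} (W : Walk k v) {i j} → i < j → Path⁺ N (vertexAt W i) (vertexAt W j)
  path⁺-between (e ∷ W) {Fin.zero}  {Fin.suc j} _       = path⁺-from e W j
  path⁺-between (e ∷ W) {Fin.suc i} {Fin.suc j} (s≤s p) = path⁺-between W p

  childrenOf⇒arc : ∀ {v c} → c ∈ childrenOf N v → (v , c) ∈ A N
  childrenOf⇒arc {v} c∈ with ∈-map⁻ proj₂ c∈
  ... | _ , e∈ , refl with ∈-filter⁻ (λ e → proj₁ e ≟ v) {xs = A N} e∈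
  ... | e∈A , refl = e∈A

  singleton⇒arc : ∀ {v c} → childrenOf N v ≡ c ∷ [] → (v , c) ∈ A N
  singleton⇒arc eq = childrenOf⇒arc (subst (_ ∈_) (sym eq) (here refl))

  pathsUpTo-self : ∀ m v → pathsUpTo N m v v ≡ 1
  pathsUpTo-self zero    v = δ-diag v
  pathsUpTo-self (suc m) v rewrite dec-true (v ≟ v) refl = refl

  pathsUpTo-sink : ∀ m {c} y → childrenOf N c ≡ [] → pathsUpTo N m c y ≡ δ c y
  pathsUpTo-sink zero    y _  = refl
  pathsUpTo-sink (suc m) y eq rewrite eq = refl

  numPaths-sink : ∀ {c} y → outdeg N c ≡ 0 → numPaths N c y ≡ δ c y
  numPaths-sink y sink = pathsUpTo-sink (length (V N)) y (length≡0⇒[] _ sink)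

  pathsUpTo-suc : ∀ k {v y} → v ≢ y
                → pathsUpTo N (suc k) v y ≡ sum (map (λ c → pathsUpTo N k c y) (childrenOf N v))
  pathsUpTo-suc k {v} {y} v≢y rewrite dec-false (v ≟ y) v≢y = refl

  pathsUpTo-stable : ∀ k {v} y → ¬ Walk k v → pathsUpTo N k v y ≡ pathsUpTo N (suc k) v y
  pathsUpTo-stable zero    y ¬W = ⊥-elim (¬W [])
  pathsUpTo-stable (suc k) {v} y ¬W =
    cong (λ s → if does (v ≟ y) then 1 else s)
      (cong sum (map-cong-local (All.tabulate λ c∈ →
        pathsUpTo-stable k y (¬W ∘ (childrenOf⇒arc c∈ ∷_)))))

  pathsUpTo-children : ∀ n {v y} → ¬ Walk n v → v ≢ y
                     → pathsUpTo N n v y ≡ sum (map (λ c → pathsUpTo N n c y) (childrenOf N v))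
  pathsUpTo-children zero    ¬W _   = ⊥-elim (¬W [])
  pathsUpTo-children (suc k) {y = y} ¬W v≢y =
    trans (pathsUpTo-suc k v≢y)
      (cong sum (map-cong-local (All.tabulate λ c∈ →
        pathsUpTo-stable k y (¬W ∘ (childrenOf⇒arc c∈ ∷_)))))

module _ {N : Graph} {t : ℕ} {X : List ℕ} (L : Labelling N t) where

  clones-sym : ∀ {i j} → Clones X L i j → Clones X L j i
  clones-sym (i≢j , i~j) = ≢-sym i≢j , λ y y∈ → sym (i~j y y∈)

  maximalClones-sym : ∀ {i j} → MaximalClones X L i j → MaximalClones X L j i
  maximalClones-sym (i~j , maximal) =
    clones-sym i~j , λ (k , k≢j , k≢i , j~k , i~k) → maximal (k , k≢i , k≢j , i~k , j~k)

module _ {N N′ : Graph} {t : ℕ} {X : List ℕ} (L : Labelling N t) (L′ : Labelling N′ t) where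

  sameProfile-sym : SameProfile X L L′ → SameProfile X L′ L
  sameProfile-sym same i y y∈ = sym (same i y y∈)

  sameProfile⇒clones : SameProfile X L L′ → ∀ {i j} → Clones X L i j → Clones X L′ i j
  sameProfile⇒clones same {i} {j} (i≢j , i~j) =
    i≢j , λ y y∈ → trans (sym (same i y y∈)) (trans (i~j y y∈) (same j y y∈))

sameProfile⇒maximalClones : ∀ {N N′ : Graph} {t : ℕ} {X : List ℕ} (L : Labelling N t) (L′ : Labelling N′ t)
                          → SameProfile X L L′ → ∀ {i j} → MaximalClones X L i j → MaximalClones X L′ i j
sameProfile⇒maximalClones {X = X} L L′ same (i~j , maximal) =
  sameProfile⇒clones L L′ same i~j ,
  λ (k , k≢i , k≢j , i~k , j~k) → maximal (k , k≢i , k≢j , back i~k , back j~k)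
  where
  back : ∀ {i j} → Clones X L′ i j → Clones X L i j
  back = sameProfile⇒clones L′ L (sameProfile-sym L L′ same)

UnitProfile : Graph → List ℕ → ℕ → ℕ → Set
UnitProfile N X v x = ∀ y → y ∈ X → numPaths N v y ≡ δ x y

module _ {N : Graph} {X : List ℕ} (net : IsNetworkOn N X) where
  open IsNetworkOn net

  vertexAt∈V : ∀ {k v} → v ∈ V N → (W : Walk N k v) → ∀ i → vertexAt N W i ∈ V N
  vertexAt∈V v∈ W       Fin.zero    = v∈
  vertexAt∈V v∈ (e ∷ W) (Fin.suc i) = vertexAt∈V (proj₂ (endpoints e)) W i

  -- A walk with |V| arcs visits |V| + 1 vertices, so one of them repeats.
  ¬longWalk : ∀ {v} → v ∈ V N → ¬ Walk N (length (V N)) v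
  ¬longWalk v∈ W with pigeonhole (n<1+n (length (V N))) (index ∘ vertexAt∈V v∈ W)
  ... | i , j , i<j , same = acyclic _ (subst (Path⁺ N _) (sym repeat) (path⁺-between N W i<j))
    where
    repeat : vertexAt N W i ≡ vertexAt N W j
    repeat = index-injective (setoid ℕ) (vertexAt∈V v∈ W i) (vertexAt∈V v∈ W j) same

  unitProfile⇒≡ : ∀ {v x y} → UnitProfile N X v x → y ∈ X → 1 ≤ numPaths N v y → y ≡ x
  unitProfile⇒≡ {y = y} unit y∈ 1≤ = sym (δ-positive⇒≡ (≤-trans 1≤ (≤-reflexive (unit y y∈))))

  nonLeaf≢leaf : ∀ {v y} → ¬ outdeg N v ≡ 0 → y ∈ X → v ≢ y
  nonLeaf≢leaf ¬sink y∈ refl = ¬sink (proj₂ (Equivalence.to (leaves _) y∈))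

  numPaths-oneChild : ∀ {v c y} → childrenOf N v ≡ c ∷ [] → v ∈ V N → v ≢ y
                    → numPaths N v y ≡ numPaths N c y
  numPaths-oneChild eq v∈ v≢y =
    trans (pathsUpTo-children N _ (¬longWalk v∈) v≢y)
      (trans (cong (sum ∘ map _) eq) (+-identityʳ _))

  numPaths-twoChildren : ∀ {v c₁ c₂ y} → childrenOf N v ≡ c₁ ∷ c₂ ∷ [] → v ∈ V N → v ≢ y
                       → numPaths N v y ≡ numPaths N c₁ y + numPaths N c₂ y
  numPaths-twoChildren {c₁ = c₁} {c₂} {y} eq v∈ v≢y =
    trans (pathsUpTo-children N _ (¬longWalk v∈) v≢y)
      (trans (cong (sum ∘ map _) eq) (cong (numPaths N c₁ y +_) (+-identityʳ (numPaths N c₂ y))))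

  pathsUpTo-reachesLeaf : ∀ k {w} → w ∈ V N → ¬ Walk N k w → ∃[ y ] (y ∈ X × 1 ≤ pathsUpTo N k w y)
  pathsUpTo-reachesLeaf zero    _  ¬W = ⊥-elim (¬W [])
  pathsUpTo-reachesLeaf (suc k) {w} w∈ ¬W with outdeg N w ≟ 0
  ... | yes sink = w , Equivalence.from (leaves w) (w∈ , sink)
                     , ≤-reflexive (sym (pathsUpTo-self N (suc k) w))
  ... | no ¬sink with length≢0⇒∷ (childrenOf N w) ¬sink
  ... | c , cs , eq with pathsUpTo-reachesLeaf k (proj₂ (endpoints w→c)) (¬W ∘ (w→c ∷_))
    where
    w→c : (w , c) ∈ A N
    w→c = childrenOf⇒arc N (subst (c ∈_) (sym eq) (here refl))
  ... | y , y∈ , 1≤ with w ≟ y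
  ... | yes refl = y , y∈ , ≤-reflexive (sym (pathsUpTo-self N (suc k) y))
  ... | no w≢y = y , y∈ , (begin
      1                                                        ≤⟨ 1≤ ⟩
      pathsUpTo N k c y                                        ≤⟨ m≤m+n _ _ ⟩
      sum (map (λ u → pathsUpTo N k u y) (c ∷ cs))             ≡⟨ cong (sum ∘ map _) eq ⟨
      sum (map (λ u → pathsUpTo N k u y) (childrenOf N w))     ≡⟨ pathsUpTo-suc N k w≢y ⟨
      pathsUpTo N (suc k) w y                                  ∎)
    where open ≤-Reasoning

  reachesLeaf : ∀ {w} → w ∈ V N → ∃[ y ] (y ∈ X × 1 ≤ numPaths N w y)
  reachesLeaf w∈ = pathsUpTo-reachesLeaf _ w∈ (¬longWalk w∈)

  child∈V : ∀ {v c} → c ∈ childrenOf N v → c ∈ V N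
  child∈V = proj₂ ∘ endpoints ∘ childrenOf⇒arc N

  ¬unitProfile-outdeg2 : ∀ {v x} → v ∈ V N → outdeg N v ≡ 2 → x ∈ X → ¬ UnitProfile N X v x
  ¬unitProfile-outdeg2 {v} {x} v∈ o2 x∈ unit with length≡2⇒pair (childrenOf N v) o2
  ... | c₁ , c₂ , eq = 2≰1 (begin
      2                                  ≤⟨ +-mono-≤ (childReachesX c₁∈ (m≤m+n _ _)) (childReachesX c₂∈ (m≤n+m _ _)) ⟩
      numPaths N c₁ x + numPaths N c₂ x  ≡⟨ split x∈ ⟨
      numPaths N v x                     ≡⟨ unit x x∈ ⟩
      δ x x                              ≡⟨ δ-diag x ⟩
      1                                  ∎)
    where
    open ≤-Reasoning
    2≰1 : ¬ 2 ≤ 1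
    2≰1 (s≤s ())
    c₁∈ : c₁ ∈ V N
    c₁∈ = child∈V (subst (c₁ ∈_) (sym eq) (here refl))
    c₂∈ : c₂ ∈ V N
    c₂∈ = child∈V (subst (c₂ ∈_) (sym eq) (there (here refl)))
    split : ∀ {y} → y ∈ X → numPaths N v y ≡ numPaths N c₁ y + numPaths N c₂ y
    split y∈ = numPaths-twoChildren eq v∈ (nonLeaf≢leaf (1+n≢0 ∘ trans (sym o2)) y∈)
    childReachesX : ∀ {c} → c ∈ V N → (∀ {y} → numPaths N c y ≤ numPaths N c₁ y + numPaths N c₂ y)
                  → 1 ≤ numPaths N c x
    childReachesX {c} c∈ c≤ with reachesLeaf c∈
    ... | y , y∈ , 1≤ = subst (λ z → 1 ≤ numPaths N c z) y≡x 1≤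
      where
      y≡x : y ≡ x
      y≡x = unitProfile⇒≡ {v = v} unit y∈ (≤-trans 1≤ (≤-trans c≤ (≤-reflexive (sym (split y∈)))))

  unitProfile⇒reticulation : ∀ {v x} → NonLeaf N v → x ∈ X → UnitProfile N X v x → Reticulation N v
  unitProfile⇒reticulation {v} {x} (v∈ , ¬sink) x∈ unit with shape
  ... | inj₁ (u , V≡[u]) = ⊥-elim (nonLeaf≢leaf ¬sink x∈ (trans (only v∈) (sym (only x∈V))))
    where
    only : ∀ {z} → z ∈ V N → z ≡ u
    only z∈ with subst (_ ∈_) V≡[u] z∈
    ... | here z≡u = z≡u
    x∈V : x ∈ V N
    x∈V = proj₁ (Equivalence.to (leaves x) x∈)
  ... | inj₂ (r , _ , _ , outdeg-r , kinds) with v ≟ r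
  ... | yes refl = ⊥-elim (¬unitProfile-outdeg2 v∈ outdeg-r x∈ unit)
  ... | no v≢r with kinds v v∈ v≢r
  ... | inj₁ (_ , sink)                = ⊥-elim (¬sink sink)
  ... | inj₂ (inj₁ (_ , o2))           = ⊥-elim (¬unitProfile-outdeg2 v∈ o2 x∈ unit)
  ... | inj₂ (inj₂ (two-parents , o1)) = v∈ , two-parents , o1

  reticulation⇒child : ∀ {u} → Reticulation N u
                     → ∃[ c ] ((u , c) ∈ A N × (∀ y → y ∈ X → numPaths N u y ≡ numPaths N c y))
  reticulation⇒child {u} (u∈ , _ , o1) with length≡1⇒singleton (childrenOf N u) o1
  ... | c , eq = c , singleton⇒arc N eq ,
                 λ y y∈ → numPaths-oneChild eq u∈ (nonLeaf≢leaf (1+n≢0 ∘ trans (sym o1)) y∈)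

  module _ {t : ℕ} (L : Labelling N t) where

    maximalClones-reticulation⇒unitProfile⊎arc :
      ∀ {i j} → MaximalClones X L i j → Reticulation N (vtx L i)
      → (∃[ x ] (x ∈ X × UnitProfile N X (vtx L i) x)) ⊎ ((vtx L i , vtx L j) ∈ A N)
    maximalClones-reticulation⇒unitProfile⊎arc {i} {j} ((_ , i~j) , maximal) ret
      with reticulation⇒child ret
    ... | c , i→c , i~c with outdeg N c ≟ 0
    ... | yes sink = inj₁ (c , Equivalence.from (leaves c) (proj₂ (endpoints i→c) , sink) ,
                           λ y y∈ → trans (i~c y y∈) (numPaths-sink N y sink))
    ... | no ¬sink with surjective L c (proj₂ (endpoints i→c) , ¬sink)
    ... | k , refl with k ≟ᶠ j
    ... | yes refl = inj₂ i→c
    ... | no k≢j   = ⊥-elim (maximal (k , k≢i , k≢j , (≢-sym k≢i , i~c) ,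
                                      (≢-sym k≢j , λ y y∈ → trans (sym (i~j y y∈)) (i~c y y∈))))
      where
      k≢i : k ≢ i
      k≢i refl = acyclic _ (arc i→c)

    maximalClones-reticulations⇒unitProfile :
      ∀ {i j} → MaximalClones X L i j → Reticulation N (vtx L i) → Reticulation N (vtx L j)
      → ∃[ x ] (x ∈ X × UnitProfile N X (vtx L i) x × UnitProfile N X (vtx L j) x)
    maximalClones-reticulations⇒unitProfile mc@((_ , i~j) , _) retᵢ retⱼ
      with maximalClones-reticulation⇒unitProfile⊎arc mc retᵢ
         | maximalClones-reticulation⇒unitProfile⊎arc (maximalClones-sym L mc) retⱼ
    ... | inj₁ (x , x∈ , unit) | _ = x , x∈ , unit , λ y y∈ → trans (sym (i~j y y∈)) (unit y y∈)
    ... | inj₂ _ | inj₁ (x , x∈ , unit) = x , x∈ , (λ y y∈ → trans (i~j y y∈) (unit y y∈)) , unit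
    ... | inj₂ i→j | inj₂ j→i = ⊥-elim (acyclic _ (i→j ∷ₚ arc j→i))

reticulations-transfer :
  ∀ {X : List ℕ} {N N′ : Graph} {t : ℕ} → IsNetworkOn N X → IsNetworkOn N′ X
  → (L : Labelling N t) (L′ : Labelling N′ t) → SameProfile X L L′
  → (i j : Fin t) → MaximalClones X L i j
  → Reticulation N (vtx L i) × Reticulation N (vtx L j)
  → Reticulation N′ (vtx L′ i) × Reticulation N′ (vtx L′ j)
reticulations-transfer net net′ L L′ same i j mc (retᵢ , retⱼ)
  with maximalClones-reticulations⇒unitProfile net L mc retᵢ retⱼ
... | x , x∈ , unitᵢ , unitⱼ =
  unitProfile⇒reticulation net′ (nonLeaf L′ i) x∈ (λ y y∈ → trans (sym (same i y y∈)) (unitᵢ y y∈)) ,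
  unitProfile⇒reticulation net′ (nonLeaf L′ j) x∈ (λ y y∈ → trans (sym (same j y y∈)) (unitⱼ y y∈))

corollary4p6 : (X : List ℕ) (N N' : Graph) (t : ℕ)
    → IsNetworkOn N X → Orchard N
    → IsNetworkOn N' X → Orchard N'
    → (L : Labelling N t) (L' : Labelling N' t)
    → SameProfile X L L'
    → (i j : Fin t) → MaximalClones X L i j
    → (Reticulation N (vtx L i) × Reticulation N (vtx L j))
      ⇔ (Reticulation N' (vtx L' i) × Reticulation N' (vtx L' j))
corollary4p6 X N N' t net _ net' _ L L' same i j mc =
  mk⇔ (reticulations-transfer net net' L L' same i j mc)
      (reticulations-transfer net' net L' L (sameProfile-sym L L' same) i j
        (sameProfile⇒maximalClones L L' same mc))
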